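{- Let $C$ be an $(X,1)$-neighbour transitive code in $H(m,q)$ with minimum distance $\delta\ge3$ and $|C|>1$. Then $X_1^Q$ acts $2$-transitively on $Q$.
   Context: The Hamming graph $H(m,q)$ has vertices the $m$-tuples over an alphabet $Q$ ($|Q|=q\ge2$) indexed by the entry set $M=\{1,\dots,m\}$, adjacent iff differing in one entry. $\mathrm{Aut}(H(m,q))=N\rtimes L$, $N\cong S_q^m$ acting entrywise ($\alpha^g=(\alpha_1^{g_1},\dots,\alpha_m^{g_m})$), $L\cong S_m$ permuting entries. For a subgroup $X$, $X_1$ is the stabiliser in $X$ of entry $1$ (elements $(h_1,\dots,h_m)\sigma$ with $1^\sigma=1$), and $X_1^Q$ is the image of $X_1$ under $(h_1,\dots,h_m)\sigma\mapsto h_1\in\mathrm{Sym}(Q)$. For a code $C$, $\delta$ is its minimum distance, $C_1$ the set of vertices at distance exactly $1$ from $C$, $\mathrm{Aut}(C)$ its setwise stabiliser; for $X\le\mathrm{Aut}(C)$, $C$ is $(X,1)$-neighbour transitive if $X$ is transitive on $C$ and on $C_1$. -}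

module Defs where

open import Data.Nat using (ℕ; _≤_; _<_)
open import Data.Fin using (Fin; _≟_; fromℕ<)
open import Data.Fin.Permutation using (Permutation′; _⟨$⟩ʳ_; _⟨$⟩ˡ_; id; flip; _∘ₚ_)
open import Data.Vec using (Vec; lookup; tabulate)
open import Data.List using (length; filter; allFin)
open import Data.Product using (Σ; ∃; _×_; _,_)
open import Relation.Nullary using (¬_; ¬?)
open import Relation.Binary.PropositionalEquality using (_≡_)

-- Vertices of H(m,q): m-tuples over Q = Fin q, entries indexed by M = Fin m.
Vertex : ℕ → ℕ → Set
Vertex m q = Vec (Fin q) m

dist : ∀ {m q} → Vertex m q → Vertex m q → ℕ
dist {m} α β = length (filter (λ i → ¬? (lookup α i ≟ lookup β i)) (allFin m))

-- An element (h_1,...,h_m)σ of Aut(H(m,q)) = N ⋊ L.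
record Aut (m q : ℕ) : Set where
  constructor _▸_
  field
    h : Fin m → Permutation′ q
    σ : Permutation′ m
open Aut public

-- Right action: α^{hσ} has entry i^σ equal to α_i^{h_i}.
act : ∀ {m q} → Vertex m q → Aut m q → Vertex m q
act α (h ▸ σ) = tabulate λ j → h (σ ⟨$⟩ˡ j) ⟨$⟩ʳ lookup α (σ ⟨$⟩ˡ j)

-- Group structure (product g·g' means "first g, then g'", matching the right action).
one : ∀ {m q} → Aut m q
one = (λ _ → id) ▸ id

_·_ : ∀ {m q} → Aut m q → Aut m q → Aut m q
(h ▸ σ) · (h′ ▸ σ′) = (λ i → h i ∘ₚ h′ (σ ⟨$⟩ʳ i)) ▸ (σ ∘ₚ σ′)

inv : ∀ {m q} → Aut m q → Aut m q
inv (h ▸ σ) = (λ j → flip (h (σ ⟨$⟩ˡ j))) ▸ flip σ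

record IsSubgroup {m q : ℕ} (X : Aut m q → Set) : Set where
  field
    one-closed : X one
    ·-closed   : ∀ {g g′} → X g → X g′ → X (g · g′)
    inv-closed : ∀ {g} → X g → X (inv g)

Code : ℕ → ℕ → Set₁
Code m q = Vertex m q → Set

MinDist≥3 : ∀ {m q} → Code m q → Set
MinDist≥3 C = ∀ α β → C α → C β → 0 < dist α β → 3 ≤ dist α β

NonTrivial : ∀ {m q} → Code m q → Set
NonTrivial C = Σ _ λ α → Σ _ λ β → C α × C β × 0 < dist α β

C₁ : ∀ {m q} → Code m q → Code m q
C₁ C β = (Σ _ λ α → C α × dist α β ≡ 1) × (∀ α → C α → 1 ≤ dist α β)

StabilisesCode : ∀ {m q} → (Aut m q → Set) → Code m q → Set
StabilisesCode X C = ∀ g → X g → ∀ α → (C α → C (act α g)) × (C (act α g) → C α)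

Transitive : ∀ {m q} → (Aut m q → Set) → Code m q → Set
Transitive X S = ∀ α β → S α → S β → Σ _ λ g → X g × act α g ≡ β

NeighbourTransitive : ∀ {m q} → (Aut m q → Set) → Code m q → Set
NeighbourTransitive X C = Transitive X C × Transitive X (C₁ C)

-- X_1^Q is 2-transitive on Q, where entry 1 is e : Fin m.
TwoTransitiveAt : ∀ {m q} → (Aut m q → Set) → Fin m → Set
TwoTransitiveAt {q = q} X e =
  ∀ (a b c d : Fin q) → ¬ a ≡ b → ¬ c ≡ d →
    Σ _ λ g → X g × σ g ⟨$⟩ʳ e ≡ e × h g e ⟨$⟩ʳ a ≡ c × h g e ⟨$⟩ʳ b ≡ d

module Submission where

-- Fix a codeword α and write e for entry 1.  Since δ ≥ 3, every neighbour α[i≔x] of α lies in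
-- C₁ and α is the only codeword within distance 1 of it; so an element of X carrying α[i≔x] to
-- α[j≔y] must fix α, send entry i to j and the symbol x to y (local-action).  Taking i = j = e
-- shows that the stabiliser of α_e in X_e^Q is transitive on the remaining symbols.  Using a
-- second codeword and transitivity of X on C one finds an element of X_e moving α_e.  The
-- classical criterion "point stabiliser transitive on the other points, and the point moved
-- ⇒ 2-transitive" then finishes the proof.

open import Defs
open import Data.Nat using (ℕ; zero; suc; _+_; _≤_; _<_; z≤n; s≤s)
open import Data.Nat.Properties
  using (≤-refl; module ≤-Reasoning; ≤-trans; ≤-reflexive; ≤-antisym; +-mono-≤; m+n≡0⇒m≡0; m+n≡0⇒n≡0;
         n≢0⇒n>0; n≤0⇒n≡0; ≮⇒≥; ≤⇒≯; +-commutativeSemigroup)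
open import Algebra.Properties.CommutativeSemigroup +-commutativeSemigroup using (interchange)
open import Data.Bool using (true; false; if_then_else_)
open import Data.Fin using (Fin; zero; suc; _≟_; fromℕ<; punchIn)
open import Data.Fin.Properties using (suc-injective; punchInᵢ≢i)
open import Data.Fin.Permutation using (Permutation′; _⟨$⟩ʳ_; _⟨$⟩ˡ_; inverseˡ; inverseʳ)
open import Data.Vec using (Vec; []; _∷_; lookup; _[_]≔_)
import Data.Vec as Vec
open import Data.Vec.Properties using (tabulate-cong; tabulate∘lookup; lookup∘tabulate; lookup∘update; lookup∘update′)
open import Data.List using (List; []; _∷_; length; filter; map; tabulate; allFin)
open import Data.List.Properties using (map-tabulate)
open import Data.Product using (Σ; ∃; _×_; _,_; proj₁; proj₂; map₂; assocʳ′)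
open import Data.Empty using (⊥-elim)
open import Function using (_∘_; id)
open import Relation.Nullary using (¬?; yes; no; does)
open import Relation.Unary using (Decidable)
open import Relation.Binary.Definitions using (DecidableEquality)
open import Relation.Binary.PropositionalEquality
  using (_≡_; _≢_; refl; sym; trans; cong; cong₂; subst; module ≡-Reasoning)

length-filter-map : ∀ {A B : Set} {P : A → Set} (P? : Decidable P) (g : B → A) (xs : List B) →
  length (filter P? (map g xs)) ≡ length (filter (P? ∘ g) xs)
length-filter-map P? g [] = refl
length-filter-map P? g (x ∷ xs) with does (P? (g x))
... | true  = cong suc (length-filter-map P? g xs)
... | false = length-filter-map P? g xs

mismatch : ∀ {q} → Fin q → Fin q → ℕ
mismatch a b = if does (a ≟ b) then 0 else 1

mismatch-≡ : ∀ {q} {a b : Fin q} → a ≡ b → mismatch a b ≡ 0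
mismatch-≡ {a = a} refl with a ≟ a
... | yes _  = refl
... | no a≢a = ⊥-elim (a≢a refl)

mismatch≡0⇒≡ : ∀ {q} (a b : Fin q) → mismatch a b ≡ 0 → a ≡ b
mismatch≡0⇒≡ a b _ with a ≟ b
... | yes a≡b = a≡b

mismatch≤1 : ∀ {q} (a b : Fin q) → mismatch a b ≤ 1
mismatch≤1 a b with a ≟ b
... | yes _ = z≤n
... | no _  = ≤-refl

mismatch-triangle : ∀ {q} (a b v : Fin q) → mismatch a b ≤ mismatch a v + mismatch b v
mismatch-triangle a b v with a ≟ b | a ≟ v | b ≟ v
... | yes _ | _     | _     = z≤n
... | no _  | no _  | _     = s≤s z≤n
... | no _  | yes _ | no _  = s≤s z≤n
... | no a≢b | yes refl | yes refl = ⊥-elim (a≢b refl)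

dist-tail : ∀ {m q} (a b : Fin q) (α β : Vertex m q) →
  length (filter (λ i → ¬? (lookup (a ∷ α) i ≟ lookup (b ∷ β) i)) (tabulate suc)) ≡ dist α β
dist-tail {m} a b α β = begin
  length (filter differ? (tabulate suc))           ≡⟨ cong (length ∘ filter differ?) (sym (map-tabulate id suc)) ⟩
  length (filter differ? (map suc (allFin m)))     ≡⟨ length-filter-map differ? suc (allFin m) ⟩
  dist α β                                          ∎
  where
  open ≡-Reasoning
  differ? : Decidable λ i → lookup (a ∷ α) i ≢ lookup (b ∷ β) i
  differ? = λ i → ¬? (lookup (a ∷ α) i ≟ lookup (b ∷ β) i)

dist-cons : ∀ {m q} (a b : Fin q) (α β : Vertex m q) →
  dist (a ∷ α) (b ∷ β) ≡ mismatch a b + dist α β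
dist-cons a b α β with a ≟ b
... | yes _ = dist-tail a b α β
... | no _  = cong suc (dist-tail a b α β)

AgreeOutside : ∀ {m q} → Fin m → Vertex m q → Vertex m q → Set
AgreeOutside p α β = ∀ k → k ≢ p → lookup α k ≡ lookup β k

dist≡0⇒≡ : ∀ {m q} (α β : Vertex m q) → dist α β ≡ 0 → α ≡ β
dist≡0⇒≡ []      []      _   = refl
dist≡0⇒≡ (a ∷ α) (b ∷ β) d≡0 =
  cong₂ _∷_ (mismatch≡0⇒≡ a b (m+n≡0⇒m≡0 _ split)) (dist≡0⇒≡ α β (m+n≡0⇒n≡0 _ split))
  where
  split : mismatch a b + dist α β ≡ 0
  split = trans (sym (dist-cons a b α β)) d≡0

agree⇒dist≡0 : ∀ {m q} (α β : Vertex m q) → (∀ k → lookup α k ≡ lookup β k) → dist α β ≡ 0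
agree⇒dist≡0 []      []      _     = refl
agree⇒dist≡0 (a ∷ α) (b ∷ β) agree = begin
  dist (a ∷ α) (b ∷ β)          ≡⟨ dist-cons a b α β ⟩
  mismatch a b + dist α β       ≡⟨ cong₂ _+_ (mismatch-≡ (agree zero)) (agree⇒dist≡0 α β (agree ∘ suc)) ⟩
  0                             ∎
  where open ≡-Reasoning

agree-outside⇒dist≤1 : ∀ {m q} (α β : Vertex m q) p → AgreeOutside p α β → dist α β ≤ 1
agree-outside⇒dist≤1 (a ∷ α) (b ∷ β) zero agree = begin
  dist (a ∷ α) (b ∷ β)         ≡⟨ dist-cons a b α β ⟩
  mismatch a b + dist α β      ≡⟨ cong (mismatch a b +_) (agree⇒dist≡0 α β λ k → agree (suc k) λ ()) ⟩
  mismatch a b + 0             ≤⟨ +-mono-≤ (mismatch≤1 a b) z≤n ⟩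
  1                            ∎
  where open ≤-Reasoning
agree-outside⇒dist≤1 (a ∷ α) (b ∷ β) (suc p) agree = begin
  dist (a ∷ α) (b ∷ β)         ≡⟨ dist-cons a b α β ⟩
  mismatch a b + dist α β      ≡⟨ cong (_+ dist α β) (mismatch-≡ (agree zero λ ())) ⟩
  dist α β                     ≤⟨ agree-outside⇒dist≤1 α β p (λ k k≢p → agree (suc k) (k≢p ∘ suc-injective)) ⟩
  1                            ∎
  where open ≤-Reasoning

dist-update : ∀ {m q} (α : Vertex m q) i x → x ≢ lookup α i → dist α (α [ i ]≔ x) ≡ 1
dist-update α i x x≢αᵢ = ≤-antisym
  (agree-outside⇒dist≤1 α ν i λ k k≢i → sym (lookup∘update′ k≢i α x))
  (n≢0⇒n>0 λ d≡0 → x≢αᵢ (begin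
    x           ≡⟨ sym (lookup∘update i α x) ⟩
    lookup ν i  ≡⟨ cong (λ γ → lookup γ i) (sym (dist≡0⇒≡ α ν d≡0)) ⟩
    lookup α i  ∎))
  where
  open ≡-Reasoning
  ν : Vertex _ _
  ν = α [ i ]≔ x

-- The triangle inequality, in the form used for balls of radius 1.
dist-triangle : ∀ {m q} (α β ν : Vertex m q) → dist α β ≤ dist α ν + dist β ν
dist-triangle []      []      []      = z≤n
dist-triangle (a ∷ α) (b ∷ β) (v ∷ ν) = begin
  dist (a ∷ α) (b ∷ β)                                      ≡⟨ dist-cons a b α β ⟩
  mismatch a b + dist α β                                   ≤⟨ +-mono-≤ (mismatch-triangle a b v) (dist-triangle α β ν) ⟩
  (mismatch a v + mismatch b v) + (dist α ν + dist β ν)     ≡⟨ interchange (mismatch a v) (mismatch b v) (dist α ν) (dist β ν) ⟩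
  (mismatch a v + dist α ν) + (mismatch b v + dist β ν)     ≡⟨ sym (cong₂ _+_ (dist-cons a v α ν) (dist-cons b v β ν)) ⟩
  dist (a ∷ α) (v ∷ ν) + dist (b ∷ β) (v ∷ ν)               ∎
  where open ≤-Reasoning

differing-entry : ∀ {m q} (α β : Vertex m q) → 0 < dist α β → ∃ λ i → lookup α i ≢ lookup β i
differing-entry (a ∷ α) (b ∷ β) d>0 = head-or-tail (subst (0 <_) (dist-cons a b α β) d>0)
  where
  head-or-tail : 0 < mismatch a b + dist α β → ∃ λ i → lookup (a ∷ α) i ≢ lookup (b ∷ β) i
  head-or-tail _    with a ≟ b
  head-or-tail tail>0 | yes _ = let (i , αᵢ≢βᵢ) = differing-entry α β tail>0 in suc i , αᵢ≢βᵢ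
  head-or-tail _      | no a≢b = zero , a≢b

permutation-injective : ∀ {n} (π : Permutation′ n) {x y} → π ⟨$⟩ʳ x ≡ π ⟨$⟩ʳ y → x ≡ y
permutation-injective π {x} {y} πx≡πy = begin
  x                    ≡⟨ sym (inverseˡ π) ⟩
  π ⟨$⟩ˡ (π ⟨$⟩ʳ x)    ≡⟨ cong (π ⟨$⟩ˡ_) πx≡πy ⟩
  π ⟨$⟩ˡ (π ⟨$⟩ʳ y)    ≡⟨ inverseˡ π ⟩
  y                    ∎
  where open ≡-Reasoning

lookup-act : ∀ {m q} (α : Vertex m q) g k →
  lookup (act α g) k ≡ h g (σ g ⟨$⟩ˡ k) ⟨$⟩ʳ lookup α (σ g ⟨$⟩ˡ k)
lookup-act α (h ▸ σ) k = lookup∘tabulate _ k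

lookup-act-σ : ∀ {m q} (α : Vertex m q) g i → lookup (act α g) (σ g ⟨$⟩ʳ i) ≡ h g i ⟨$⟩ʳ lookup α i
lookup-act-σ α g i = trans (lookup-act α g (σ g ⟨$⟩ʳ i)) (cong (λ j → h g j ⟨$⟩ʳ lookup α j) (inverseˡ (σ g)))

lookup-act-fixed-entry : ∀ {m q} (α : Vertex m q) g e → σ g ⟨$⟩ʳ e ≡ e →
  h g e ⟨$⟩ʳ lookup α e ≡ lookup (act α g) e
lookup-act-fixed-entry α g e σe≡e = trans (sym (lookup-act-σ α g e)) (cong (lookup (act α g)) σe≡e)

lookup-extensionality : ∀ {A : Set} {n} (xs ys : Vec A n) → (∀ k → lookup xs k ≡ lookup ys k) → xs ≡ ys
lookup-extensionality xs ys same = begin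
  xs                       ≡⟨ sym (tabulate∘lookup xs) ⟩
  Vec.tabulate (lookup xs) ≡⟨ tabulate-cong same ⟩
  Vec.tabulate (lookup ys) ≡⟨ tabulate∘lookup ys ⟩
  ys                       ∎
  where open ≡-Reasoning

act-· : ∀ {m q} (α : Vertex m q) g g′ → act α (g · g′) ≡ act (act α g) g′
act-· α g g′ = lookup-extensionality (act α (g · g′)) (act (act α g) g′) entry
  where
  open ≡-Reasoning
  entry : ∀ k → lookup (act α (g · g′)) k ≡ lookup (act (act α g) g′) k
  entry k = begin
    lookup (act α (g · g′)) k
      ≡⟨ lookup-act α (g · g′) k ⟩
    h g′ (σ g ⟨$⟩ʳ i) ⟨$⟩ʳ (h g i ⟨$⟩ʳ lookup α i)
      ≡⟨ cong (λ l → h g′ l ⟨$⟩ʳ (h g i ⟨$⟩ʳ lookup α i)) (inverseʳ (σ g)) ⟩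
    h g′ j ⟨$⟩ʳ (h g i ⟨$⟩ʳ lookup α i)
      ≡⟨ cong (h g′ j ⟨$⟩ʳ_) (sym (lookup-act α g j)) ⟩
    h g′ j ⟨$⟩ʳ lookup (act α g) j
      ≡⟨ sym (lookup-act (act α g) g′ k) ⟩
    lookup (act (act α g) g′) k
      ∎
    where
    j : Fin _
    j = σ g′ ⟨$⟩ˡ k
    i : Fin _
    i = σ g ⟨$⟩ˡ j

act-agree-outside : ∀ {m q} (α β : Vertex m q) g i →
  AgreeOutside i α β → AgreeOutside (σ g ⟨$⟩ʳ i) (act α g) (act β g)
act-agree-outside α β g i agree k k≢σi = begin
  lookup (act α g) k        ≡⟨ lookup-act α g k ⟩
  h g j ⟨$⟩ʳ lookup α j     ≡⟨ cong (h g j ⟨$⟩ʳ_) (agree j j≢i) ⟩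
  h g j ⟨$⟩ʳ lookup β j     ≡⟨ sym (lookup-act β g k) ⟩
  lookup (act β g) k        ∎
  where
  open ≡-Reasoning
  j : Fin _
  j = σ g ⟨$⟩ˡ k
  j≢i : j ≢ i
  j≢i j≡i = k≢σi (trans (sym (inverseʳ (σ g))) (cong (σ g ⟨$⟩ʳ_) j≡i))

record SubgroupAction (G A : Set) : Set₁ where
  field
    member      : G → Set
    unit        : G
    _∙_         : G → G → G
    _⁻¹         : G → G
    _^_         : A → G → A
    unit-member : member unit
    ∙-member    : ∀ {g g′} → member g → member g′ → member (g ∙ g′)
    ⁻¹-member   : ∀ {g} → member g → member (g ⁻¹)
    ^-unit      : ∀ x → x ^ unit ≡ x
    ^-∙         : ∀ {g g′} → member g → member g′ → ∀ x → x ^ (g ∙ g′) ≡ (x ^ g) ^ g′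
    ^-⁻¹        : ∀ {g} → member g → ∀ x → (x ^ g) ^ (g ⁻¹) ≡ x

module TwoTransitivity {G A : Set} (𝒢 : SubgroupAction G A) (_≟ᴬ_ : DecidableEquality A) where
  open SubgroupAction 𝒢

  StabiliserTransitiveOnRest : A → Set
  StabiliserTransitiveOnRest a =
    ∀ x y → x ≢ a → y ≢ a → Σ G λ g → member g × a ^ g ≡ a × x ^ g ≡ y

  TwoTransitive : Set
  TwoTransitive = ∀ a b c d → a ≢ b → c ≢ d → Σ G λ g → member g × a ^ g ≡ c × b ^ g ≡ d

  ^-⁻¹-undo : ∀ {g x y} → member g → x ^ g ≡ y → y ^ (g ⁻¹) ≡ x
  ^-⁻¹-undo {g} mg x^g≡y = trans (cong (_^ (g ⁻¹)) (sym x^g≡y)) (^-⁻¹ mg _)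

  ^-injective : ∀ {g x y} → member g → x ^ g ≡ y ^ g → x ≡ y
  ^-injective {g} {x} {y} mg x^g≡y^g = trans (sym (^-⁻¹ mg x)) (^-⁻¹-undo mg (sym x^g≡y^g))

  module _ (a : A) (stabiliser-transitive : StabiliserTransitiveOnRest a)
           (mover : Σ G λ g → member g × a ^ g ≢ a) where

    g₀ : G
    g₀ = proj₁ mover
    mg₀ : member g₀
    mg₀ = proj₁ (proj₂ mover)
    g₀-moves-a : a ^ g₀ ≢ a
    g₀-moves-a = proj₂ (proj₂ mover)

    b₀ : A
    b₀ = a ^ g₀

    to-base : ∀ x → Σ G λ g → member g × x ^ g ≡ a
    to-base x with x ≟ᴬ a
    ... | yes x≡a = unit , unit-member , trans (^-unit x) x≡a
    ... | no x≢a with stabiliser-transitive x b₀ x≢a g₀-moves-a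
    ... | s , ms , _ , x^s≡b₀ =
      s ∙ (g₀ ⁻¹) , ∙-member ms (⁻¹-member mg₀) ,
      trans (^-∙ ms (⁻¹-member mg₀) x) (^-⁻¹-undo mg₀ (sym x^s≡b₀))

    pair-to-base : ∀ x y → x ≢ y → Σ G λ g → member g × x ^ g ≡ a × y ^ g ≡ b₀
    pair-to-base x y x≢y with to-base x
    ... | t , mt , x^t≡a with stabiliser-transitive (y ^ t) b₀ y^t≢a g₀-moves-a
      where
      y^t≢a : y ^ t ≢ a
      y^t≢a y^t≡a = x≢y (^-injective mt (trans x^t≡a (sym y^t≡a)))
    ... | s , ms , a^s≡a , y^ts≡b₀ =
      t ∙ s , ∙-member mt ms ,
      trans (^-∙ mt ms x) (trans (cong (_^ s) x^t≡a) a^s≡a) ,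
      trans (^-∙ mt ms y) y^ts≡b₀

    -- Send (a′, b′) to (a, b₀), then (a, b₀) back to (c, d).
    two-transitive : TwoTransitive
    two-transitive a′ b′ c d a′≢b′ c≢d with pair-to-base a′ b′ a′≢b′ | pair-to-base c d c≢d
    ... | g₁ , mg₁ , a′g₁≡a , b′g₁≡b₀ | g₂ , mg₂ , cg₂≡a , dg₂≡b₀ =
      g₁ ∙ (g₂ ⁻¹) , ∙-member mg₁ (⁻¹-member mg₂) ,
      trans (^-∙ mg₁ (⁻¹-member mg₂) a′) (trans (cong (_^ (g₂ ⁻¹)) a′g₁≡a) (^-⁻¹-undo mg₂ cg₂≡a)) ,
      trans (^-∙ mg₁ (⁻¹-member mg₂) b′) (trans (cong (_^ (g₂ ⁻¹)) b′g₁≡b₀) (^-⁻¹-undo mg₂ dg₂≡b₀))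

-- The stabiliser X_e of entry e in a subgroup X, acting on the symbols of entry e via h_e.
-- Its image is the group X_e^Q of the theorem.
entry-stabiliser-action : ∀ {m q} (X : Aut m q → Set) → IsSubgroup X → Fin m →
  SubgroupAction (Aut m q) (Fin q)
entry-stabiliser-action {m} {q} X subgroup e = record
  { member      = Member
  ; unit        = one
  ; _∙_         = _·_
  ; _⁻¹         = inv
  ; _^_         = λ x g → h g e ⟨$⟩ʳ x
  ; unit-member = one-closed , refl
  ; ∙-member    = ·-member
  ; ⁻¹-member   = inv-member
  ; ^-unit      = λ _ → refl
  ; ^-∙         = ^-·
  ; ^-⁻¹        = ^-inv
  }
  where
  open IsSubgroup subgroup
  Member : Aut m q → Set
  Member g = X g × σ g ⟨$⟩ʳ e ≡ e

  σ⁻¹-fixes : ∀ {g} → σ g ⟨$⟩ʳ e ≡ e → σ g ⟨$⟩ˡ e ≡ e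
  σ⁻¹-fixes {g} σe≡e = trans (cong (σ g ⟨$⟩ˡ_) (sym σe≡e)) (inverseˡ (σ g))

  ·-member : ∀ {g g′} → Member g → Member g′ → Member (g · g′)
  ·-member {g} {g′} (Xg , σe≡e) (Xg′ , σ′e≡e) = ·-closed Xg Xg′ , trans (cong (σ g′ ⟨$⟩ʳ_) σe≡e) σ′e≡e

  inv-member : ∀ {g} → Member g → Member (inv g)
  inv-member {g} (Xg , σe≡e) = inv-closed Xg , σ⁻¹-fixes {g} σe≡e

  ^-· : ∀ {g g′} → Member g → Member g′ → ∀ x → h (g · g′) e ⟨$⟩ʳ x ≡ h g′ e ⟨$⟩ʳ (h g e ⟨$⟩ʳ x)
  ^-· {g} {g′} (_ , σe≡e) _ x = cong (λ j → h g′ j ⟨$⟩ʳ (h g e ⟨$⟩ʳ x)) σe≡e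

  ^-inv : ∀ {g} → Member g → ∀ x → h (inv g) e ⟨$⟩ʳ (h g e ⟨$⟩ʳ x) ≡ x
  ^-inv {g} (_ , σe≡e) x =
    trans (cong (λ j → h g j ⟨$⟩ˡ (h g e ⟨$⟩ʳ x)) (σ⁻¹-fixes {g} σe≡e)) (inverseˡ (h g e))

other-symbol : ∀ {q} → 2 ≤ q → (a : Fin q) → ∃ λ b → b ≢ a
other-symbol (s≤s (s≤s _)) a = punchIn a zero , punchInᵢ≢i a zero

module RadiusOne {m q} (C : Code m q) (δ≥3 : MinDist≥3 C) where

  codewords-close⇒equal : ∀ α β → C α → C β → dist α β ≤ 2 → α ≡ β
  codewords-close⇒equal α β Cα Cβ d≤2 =
    dist≡0⇒≡ α β (n≤0⇒n≡0 (≮⇒≥ λ d>0 → ≤⇒≯ d≤2 (δ≥3 α β Cα Cβ d>0)))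

  codeword-within-1-unique : ∀ α β ν → C α → C β → dist α ν ≤ 1 → dist β ν ≤ 1 → α ≡ β
  codeword-within-1-unique α β ν Cα Cβ dα dβ =
    codewords-close⇒equal α β Cα Cβ (≤-trans (dist-triangle α β ν) (+-mono-≤ dα dβ))

  neighbour-in-C₁ : ∀ α i x → C α → x ≢ lookup α i → C₁ C (α [ i ]≔ x)
  neighbour-in-C₁ α i x Cα x≢αᵢ = (α , Cα , dist-update α i x x≢αᵢ) , not-a-codeword
    where
    ν : Vertex m q
    ν = α [ i ]≔ x
    not-a-codeword : ∀ γ → C γ → 1 ≤ dist γ ν
    not-a-codeword γ Cγ = n≢0⇒n>0 λ d≡0 → x≢αᵢ (begin
      x             ≡⟨ sym (lookup∘update i α x) ⟩
      lookup ν i    ≡⟨ cong (λ β → lookup β i) (sym (α≡ν (subst C (dist≡0⇒≡ γ ν d≡0) Cγ))) ⟩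
      lookup α i    ∎)
      where
      open ≡-Reasoning
      α≡ν : C ν → α ≡ ν
      α≡ν Cν = codewords-close⇒equal α ν Cα Cν (≤-trans (≤-reflexive (dist-update α i x x≢αᵢ)) (s≤s z≤n))

module NeighbourTransitiveCode {m q} (X : Aut m q → Set) (C : Code m q)
  (subgroup : IsSubgroup X) (stabilises : StabilisesCode X C)
  (transitive-C : Transitive X C) (transitive-C₁ : Transitive X (C₁ C))
  (δ≥3 : MinDist≥3 C) (2≤q : 2 ≤ q) where

  open IsSubgroup subgroup using (·-closed)
  open RadiusOne C δ≥3

  image-codeword : ∀ α g → X g → C α → C (act α g)
  image-codeword α g Xg = proj₁ (stabilises g Xg α)

  -- An element of X sending a neighbour of the codeword α to a vertex within distance 1 of α
  -- fixes α: the image of α is a codeword within distance 1 of that vertex.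
  fixes-centre : ∀ α i x g ν′ → C α → X g → act (α [ i ]≔ x) g ≡ ν′ → dist α ν′ ≤ 1 → act α g ≡ α
  fixes-centre α i x g ν′ Cα Xg gν≡ν′ dαν′ =
    codeword-within-1-unique (act α g) α ν′ (image-codeword α g Xg Cα) Cα dα^gν′ dαν′
    where
    agree : AgreeOutside (σ g ⟨$⟩ʳ i) (act α g) ν′
    agree = subst (AgreeOutside (σ g ⟨$⟩ʳ i) (act α g)) gν≡ν′
      (act-agree-outside α (α [ i ]≔ x) g i λ k k≢i → sym (lookup∘update′ k≢i α x))
    dα^gν′ : dist (act α g) ν′ ≤ 1
    dα^gν′ = agree-outside⇒dist≤1 (act α g) ν′ (σ g ⟨$⟩ʳ i) agree

  -- The stabiliser of a codeword α in X can send entry i to any entry j, and at the same time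
  -- any symbol x ≠ α_i to any symbol y ≠ α_j: it is induced by an element of X mapping the
  -- neighbour α[i≔x] to the neighbour α[j≔y].
  local-action : ∀ α i x j y → C α → x ≢ lookup α i → y ≢ lookup α j →
    Σ (Aut m q) λ g → X g × act α g ≡ α × σ g ⟨$⟩ʳ i ≡ j × h g i ⟨$⟩ʳ x ≡ y
  local-action α i x j y Cα x≢αᵢ y≢αⱼ =
    conclude (transitive-C₁ ν ν′ (neighbour-in-C₁ α i x Cα x≢αᵢ) (neighbour-in-C₁ α j y Cα y≢αⱼ))
    where
    ν ν′ : Vertex m q
    ν  = α [ i ]≔ x
    ν′ = α [ j ]≔ y
    conclude : (Σ (Aut m q) λ g → X g × act ν g ≡ ν′) →
      Σ (Aut m q) λ g → X g × act α g ≡ α × σ g ⟨$⟩ʳ i ≡ j × h g i ⟨$⟩ʳ x ≡ y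
    conclude (g , Xg , gν≡ν′) = g , Xg , g-fixes-α , σi≡j , hx≡y
      where
      open ≡-Reasoning
      g-fixes-α : act α g ≡ α
      g-fixes-α = fixes-centre α i x g ν′ Cα Xg gν≡ν′ (≤-reflexive (dist-update α j y y≢αⱼ))
      hx≡ν′ : h g i ⟨$⟩ʳ x ≡ lookup ν′ (σ g ⟨$⟩ʳ i)
      hx≡ν′ = begin
        h g i ⟨$⟩ʳ x                 ≡⟨ cong (h g i ⟨$⟩ʳ_) (sym (lookup∘update i α x)) ⟩
        h g i ⟨$⟩ʳ lookup ν i        ≡⟨ sym (lookup-act-σ ν g i) ⟩
        lookup (act ν g) (σ g ⟨$⟩ʳ i) ≡⟨ cong (λ β → lookup β (σ g ⟨$⟩ʳ i)) gν≡ν′ ⟩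
        lookup ν′ (σ g ⟨$⟩ʳ i)       ∎
      -- Otherwise h_i would send both x and α_i to the same symbol of α.
      σi≡j : σ g ⟨$⟩ʳ i ≡ j
      σi≡j with σ g ⟨$⟩ʳ i ≟ j
      ... | yes σi≡j = σi≡j
      ... | no σi≢j  = ⊥-elim (x≢αᵢ (permutation-injective (h g i) (begin
        h g i ⟨$⟩ʳ x                  ≡⟨ hx≡ν′ ⟩
        lookup ν′ (σ g ⟨$⟩ʳ i)        ≡⟨ lookup∘update′ σi≢j α y ⟩
        lookup α (σ g ⟨$⟩ʳ i)         ≡⟨ cong (λ β → lookup β (σ g ⟨$⟩ʳ i)) (sym g-fixes-α) ⟩
        lookup (act α g) (σ g ⟨$⟩ʳ i) ≡⟨ lookup-act-σ α g i ⟩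
        h g i ⟨$⟩ʳ lookup α i         ∎)))
      hx≡y : h g i ⟨$⟩ʳ x ≡ y
      hx≡y = begin
        h g i ⟨$⟩ʳ x                 ≡⟨ hx≡ν′ ⟩
        lookup ν′ (σ g ⟨$⟩ʳ i)       ≡⟨ cong (lookup ν′) σi≡j ⟩
        lookup ν′ j                  ≡⟨ lookup∘update j α y ⟩
        y                            ∎

  -- Any codeword can be mapped to any other by an element of X fixing a prescribed entry e:
  -- follow an element of X by one of the stabiliser of the target moving its entry back to e.
  entry-fixing-transfer : ∀ α γ e → C α → C γ →
    Σ (Aut m q) λ g → X g × σ g ⟨$⟩ʳ e ≡ e × act α g ≡ γ
  entry-fixing-transfer α γ e Cα Cγ with transitive-C α γ Cα Cγ
  ... | k , Xk , kα≡γ with other-symbol 2≤q (lookup γ (σ k ⟨$⟩ʳ e)) | other-symbol 2≤q (lookup γ e)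
  ... | x , x≢γⱼ | y , y≢γₑ with local-action γ (σ k ⟨$⟩ʳ e) x e y Cγ x≢γⱼ y≢γₑ
  ... | k′ , Xk′ , k′γ≡γ , σ′j≡e , _ = k · k′ , ·-closed Xk Xk′ , σ′j≡e , (begin
    act α (k · k′)        ≡⟨ act-· α k k′ ⟩
    act (act α k) k′      ≡⟨ cong (λ β → act β k′) kα≡γ ⟩
    act γ k′              ≡⟨ k′γ≡γ ⟩
    γ                     ∎)
    where open ≡-Reasoning

  -- Two distinct codewords yield a codeword whose entry e differs from that of the first:
  -- move an entry where they differ to e by the stabiliser of the first codeword.
  codeword-differing-at : ∀ α β e → C α → C β → 0 < dist α β →
    Σ (Vertex m q) λ γ → C γ × lookup γ e ≢ lookup α e
  codeword-differing-at α β e Cα Cβ d>0 with differing-entry α β d>0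
  ... | i , αᵢ≢βᵢ with other-symbol 2≤q (lookup α e)
  ... | y , y≢αₑ with local-action α i (lookup β i) e y Cα (αᵢ≢βᵢ ∘ sym) y≢αₑ
  ... | g , Xg , _ , σi≡e , hβᵢ≡y = act β g , image-codeword β g Xg Cβ , γₑ≢αₑ
    where
    open ≡-Reasoning
    γₑ≢αₑ : lookup (act β g) e ≢ lookup α e
    γₑ≢αₑ γₑ≡αₑ = y≢αₑ (begin
      y                              ≡⟨ sym hβᵢ≡y ⟩
      h g i ⟨$⟩ʳ lookup β i          ≡⟨ sym (lookup-act-σ β g i) ⟩
      lookup (act β g) (σ g ⟨$⟩ʳ i)  ≡⟨ cong (lookup (act β g)) σi≡e ⟩
      lookup (act β g) e             ≡⟨ γₑ≡αₑ ⟩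
      lookup α e                     ∎)

  module AtEntry (e : Fin m) where

    open SubgroupAction (entry-stabiliser-action X subgroup e) using (member; _^_)
    open TwoTransitivity (entry-stabiliser-action X subgroup e) _≟_ public

    stabiliser-transitive-on-rest : ∀ α → C α → StabiliserTransitiveOnRest (lookup α e)
    stabiliser-transitive-on-rest α Cα x y x≢αₑ y≢αₑ with local-action α e x e y Cα x≢αₑ y≢αₑ
    ... | g , Xg , gα≡α , σe≡e , hx≡y =
      g , (Xg , σe≡e) , trans (lookup-act-fixed-entry α g e σe≡e) (cong (λ β → lookup β e) gα≡α) , hx≡y

    symbol-moved : ∀ α β → C α → C β → 0 < dist α β →
      Σ (Aut m q) λ g → member g × lookup α e ^ g ≢ lookup α e
    symbol-moved α β Cα Cβ d>0 with codeword-differing-at α β e Cα Cβ d>0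
    ... | γ , Cγ , γₑ≢αₑ with entry-fixing-transfer α γ e Cα Cγ
    ... | g , Xg , σe≡e , gα≡γ =
      g , (Xg , σe≡e) ,
      λ moved≡αₑ → γₑ≢αₑ (trans (sym (cong (λ β → lookup β e) gα≡γ))
                                (trans (sym (lookup-act-fixed-entry α g e σe≡e)) moved≡αₑ))

-- The stabiliser of a codeword symbol is transitive on the other
-- symbols, and the symbol is moved, so the criterion applies.
proposition2p7 : ∀ (m q : ℕ) (0<m : 0 < m) → 2 ≤ q →
    ∀ (X : Aut m q → Set) (C : Code m q) →
    IsSubgroup X → StabilisesCode X C →
    NeighbourTransitive X C → MinDist≥3 C → NonTrivial C →
    TwoTransitiveAt X (fromℕ< 0<m)
proposition2p7 m q 0<m 2≤q X C subgroup stabilises (transitive-C , transitive-C₁) δ≥3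
  (α , β , Cα , Cβ , d>0) a b c d a≢b c≢d =
  map₂ assocʳ′ (two-transitive (lookup α e) (stabiliser-transitive-on-rest α Cα)
                  (symbol-moved α β Cα Cβ d>0) a b c d a≢b c≢d)
  where
  e : Fin m
  e = fromℕ< 0<m
  open NeighbourTransitiveCode X C subgroup stabilises transitive-C transitive-C₁ δ≥3 2≤q
  open AtEntry e
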